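{- Let $W\subseteq\mathbb{R}^n$ be a rational linear subspace. Then $\dot\kappa_W$ is the smallest positive integer $k$ such that for every $d\in\mathbb{Z}^n$, the polyhedron $\{x\in\mathbb{R}^n:\ x\in W+d,\ x\ge 0\}$ is $1/k$-integral.
   Context: A linear subspace is rational if it has a basis of rational vectors. An elementary vector of $W$ is a nonzero $g\in W$ with inclusion-minimal support among nonzero vectors of $W$; a circuit is the support $C$ of an elementary vector. For rational $W$ and a circuit $C$, $g^C$ denotes the integer elementary vector with support $C$ whose entries have greatest common divisor 1 (unique up to sign). The lcm-circuit imbalance measure is $\dot\kappa_W=\mathrm{lcm}\{|g^C_i|:\ C \text{ a circuit of } W,\ i\in C\}$ for nontrivial $W$, and $\dot\kappa_W=1$ for $W\in\{\{0\},\mathbb{R}^n\}$. A number is $1/k$-integral if it is an integer multiple of $1/k$; a polyhedron is $1/k$-integral if all its vertices have $1/k$-integral coordinates.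
   Formalization: The polyhedron and its vertices are taken over ℚ^n in place of ℝ^n, with extremality tested only against rational points, and W is represented by its rational vectors. -}

module Defs where

open import Data.Nat as ℕ using (ℕ; zero; suc)
open import Data.Nat.Divisibility using (_∣_)
open import Data.Integer as ℤ using (ℤ; +_; ∣_∣)
open import Data.Rational as ℚ using (ℚ; 0ℚ; _+_; _-_; _*_; _/_; _≤_; _≟_)
open import Data.Fin using (Fin; zero; suc)
open import Data.Fin.Subset using (Subset; _∈_; _⊆_; inside; outside)
open import Data.Vec using (tabulate)
open import Data.Product using (Σ; ∃; _×_)
open import Data.Bool using (if_then_else_)
open import Relation.Nullary using (¬_; does)
open import Relation.Binary.PropositionalEquality using (_≡_)

Vecℚ : ℕ → Set
Vecℚ n = Fin n → ℚ

sumFin : ∀ {m} → (Fin m → ℚ) → ℚ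
sumFin {zero}  f = 0ℚ
sumFin {suc m} f = f zero + sumFin (λ j → f (suc j))

-- W = span of the rational vectors B j (a rational linear subspace of ℚ^n)
InSpan : ∀ {m n} → (Fin m → Vecℚ n) → Vecℚ n → Set
InSpan B x = ∃ λ (c : Fin _ → ℚ) → ∀ i → x i ≡ sumFin (λ j → c j * B j i)

NonZeroVec : ∀ {n} → Vecℚ n → Set
NonZeroVec x = ¬ (∀ i → x i ≡ 0ℚ)

supp : ∀ {n} → Vecℚ n → Subset n
supp x = tabulate (λ i → if does (x i ≟ 0ℚ) then outside else inside)

Elementary : ∀ {m n} → (Fin m → Vecℚ n) → Vecℚ n → Set
Elementary B g = InSpan B g × NonZeroVec g ×
  (∀ h → InSpan B h → NonZeroVec h → supp h ⊆ supp g → supp g ⊆ supp h)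

Circuit : ∀ {m n} → (Fin m → Vecℚ n) → Subset n → Set
Circuit B C = ∃ λ g → Elementary B g × supp g ≡ C

toℚv : ∀ {n} → (Fin n → ℤ) → Vecℚ n
toℚv g i = g i / 1

Primitive : ∀ {n} → (Fin n → ℤ) → Set
Primitive g = ∀ d → (∀ i → d ∣ ∣ g i ∣) → d ∣ 1

-- g is (±) g^C : integer vector in W with support C and gcd 1
IsNormElem : ∀ {m n} → (Fin m → Vecℚ n) → Subset n → (Fin n → ℤ) → Set
IsNormElem B C g = InSpan B (toℚv g) × supp (toℚv g) ≡ C × Primitive g

Entry : ∀ {m n} → (Fin m → Vecℚ n) → ℕ → Set
Entry {n = n} B a = ∃ λ (C : Subset n) → ∃ λ (g : Fin n → ℤ) → ∃ λ (i : Fin n) →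
  Circuit B C × IsNormElem B C g × i ∈ C × a ≡ ∣ g i ∣

-- κ is the lcm of the set S ⊆ ℕ (universal property; lcm of ∅ is 1)
IsLCM : (ℕ → Set) → ℕ → Set
IsLCM S κ = (∀ a → S a → a ∣ κ) × (∀ L → (∀ a → S a → a ∣ L) → κ ∣ L)

IsKappa : ∀ {m n} → (Fin m → Vecℚ n) → ℕ → Set
IsKappa B κ = IsLCM (Entry B) κ

InPoly : ∀ {m n} → (Fin m → Vecℚ n) → (Fin n → ℤ) → Vecℚ n → Set
InPoly B d x = InSpan B (λ i → x i - (d i / 1)) × (∀ i → 0ℚ ≤ x i)

-- vertex = extreme point: not the midpoint of two distinct points of the polyhedron
Vertex : ∀ {m n} → (Fin m → Vecℚ n) → (Fin n → ℤ) → Vecℚ n → Set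
Vertex B d x = InPoly B d x ×
  (∀ (y : Vecℚ _) → InPoly B d (λ i → x i + y i) → InPoly B d (λ i → x i - y i) → ∀ i → y i ≡ 0ℚ)

FracIntegral : ℕ → ℚ → Set
FracIntegral k q = ∃ λ (z : ℤ) → (+ k / 1) * q ≡ z / 1

AllPolyIntegral : ∀ {m n} → (Fin m → Vecℚ n) → ℕ → Set
AllPolyIntegral {n = n} B k =
  ∀ (d : Fin n → ℤ) (x : Vecℚ n) → Vertex B d x → ∀ i → FracIntegral k (x i)

module Submission where

-- κ̇ suffices. At a vertex x of P_d = {x ∈ W + d : x ≥ 0} the only vector of W supported
-- inside supp x is 0, and v = x − d ∈ W is integral where x vanishes. Clear these
-- coordinates j one at a time: if some nonzero h ∈ W vanishes on the coordinates still to be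
-- treated and on those already cleared, then h is elementary with hⱼ ≠ 0, and replacing v by
-- v − (vⱼ/hⱼ) h changes κ̇ v by vⱼ · κ̇ h/hⱼ, which is integral because hⱼ divides κ̇ once h
-- is normalised; otherwise j can simply be dropped. When nothing is left, v = 0. Hence
-- κ̇ v, and so κ̇ x, is integral.
--
-- κ̇ is needed. For a circuit C, i ∈ C and g = gᶜ, the point x = d − g/gᵢ with dₗ = |gₗ|
-- for l ≠ i and dᵢ = 1 is a vertex of P_d. If k x is integral then gᵢ ∣ k gₗ for every l,
-- hence gᵢ ∣ k because g is primitive; so κ̇ ∣ k.
--
-- Constructively, κ̇ is computed by running over all subsets C: whether C is a circuit is
-- decidable, because Gaussian elimination decides whether W contains a nonzero vector
-- vanishing on a given list of coordinates.

open import Defs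

open import Data.Bool using (true; false; if_then_else_)
open import Data.Empty using (⊥-elim)
open import Data.Fin using (Fin; zero; suc)
import Data.Fin.Properties as Finₚ
open import Data.Fin.Subset using (Subset; _∈_; _∉_; _⊆_; inside; outside)
open import Data.Fin.Subset.Properties using (_∈?_; ⊆-refl; ⊆-reflexive; ⊆-antisym)
open import Data.Integer as ℤ using (ℤ; +_; ∣_∣)
import Data.Integer.Divisibility.Signed as ℤ∣
import Data.Integer.Properties as ℤₚ
open import Data.List as List using (List; []; _∷_)
open import Data.List.Membership.Propositional.Properties using (∈-filter⁺; ∈-filter⁻; ∈-allFin)
open import Data.List.Relation.Unary.All as All using (All; []; _∷_)
import Data.List.Relation.Unary.All.Properties as Allₚ
open import Data.Nat as ℕ using (ℕ; zero; suc; _<_; _≤_)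
import Data.Nat.Coprimality as Coprime
open import Data.Nat.Divisibility
  using (_∣_; divides; ∣-refl; ∣-trans; ∣-antisym; ∣1⇒≡1; n∣m*n; 0∣⇒≡0; *-monoˡ-∣; *-cancelʳ-∣; ∣⇒≤)
open import Data.Nat.GCD using (gcd; gcd[m,n]∣m; gcd[m,n]∣n; gcd-greatest; c*gcd[m,n]≡gcd[cm,cn])
open import Data.Nat.LCM using (lcm; m∣lcm[m,n]; n∣lcm[m,n]; lcm-least; gcd*lcm)
import Data.Nat.Properties as ℕₚ
open import Data.Product using (Σ; ∃; _×_; _,_; proj₁; proj₂)
open import Data.Rational as ℚ using (ℚ; mkℚ; 0ℚ; 1ℚ; _+_; _-_; _*_; _/_; -_; 1/_; _≟_; ↥_; ↧ₙ_)
import Data.Rational.Properties as ℚₚ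
open import Algebra.Properties.Group ℚₚ.+-0-group using (x∙y⁻¹≈ε⇒x≈y)
open import Data.Rational.Solver using (module +-*-Solver)
import Data.Rational.Unnormalised as ℚᵘ
open import Data.Sum using (_⊎_; inj₁; inj₂)
open import Data.Vec using ([]; _∷_)
import Data.Vec.Properties as Vecₚ
open import Function using (_∘_; case_of_)
open import Relation.Binary.PropositionalEquality
open import Relation.Nullary using (¬_; Dec; yes; no; does)
open import Relation.Nullary.Decidable using (decidable-stable; ¬?; map′; _×-dec_; _→-dec_)

open +-*-Solver

ι : ℤ → ℚ
ι z = z / 1

ι≡mkℚ : ∀ z → ι z ≡ mkℚ z 0 (Coprime.sym (Coprime.1-coprimeTo _))
ι≡mkℚ z = ℚₚ.↥p/↧p≡p (mkℚ z 0 _)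

ι-homo-+ : ∀ a b → ι (a ℤ.+ b) ≡ ι a + ι b
ι-homo-+ a b rewrite ι≡mkℚ a | ι≡mkℚ b =
  cong₂ (λ x y → (x ℤ.+ y) / 1) (sym (ℤₚ.*-identityʳ a)) (sym (ℤₚ.*-identityʳ b))

ι-homo-* : ∀ a b → ι (a ℤ.* b) ≡ ι a * ι b
ι-homo-* a b rewrite ι≡mkℚ a | ι≡mkℚ b = refl

ι-homo‿- : ∀ a → ι (ℤ.- a) ≡ - ι a
ι-homo‿- a = begin
  ι (ℤ.- a)                 ≡⟨ solve 2 (λ x y → x := (x :+ y) :- y) refl (ι (ℤ.- a)) (ι a) ⟩
  (ι (ℤ.- a) + ι a) - ι a   ≡⟨ cong (_- ι a) (sym (ι-homo-+ (ℤ.- a) a)) ⟩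
  ι (ℤ.- a ℤ.+ a) - ι a     ≡⟨ cong (λ z → ι z - ι a) (ℤₚ.+-inverseˡ a) ⟩
  0ℚ - ι a                  ≡⟨ ℚₚ.+-identityˡ (- ι a) ⟩
  - ι a                     ∎
  where open ≡-Reasoning

ι-injective : ∀ {a b} → ι a ≡ ι b → a ≡ b
ι-injective {a} {b} eq = begin
  a          ≡⟨ cong ↥_ (sym (ι≡mkℚ a)) ⟩
  ↥ (ι a)    ≡⟨ cong ↥_ eq ⟩
  ↥ (ι b)    ≡⟨ cong ↥_ (ι≡mkℚ b) ⟩
  b          ∎
  where open ≡-Reasoning

ι-mono-≤ : ∀ {a b} → a ℤ.≤ b → ι a ℚ.≤ ι b
ι-mono-≤ {a} {b} a≤b rewrite ι≡mkℚ a | ι≡mkℚ b =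
  ℚ.*≤* (subst₂ ℤ._≤_ (sym (ℤₚ.*-identityʳ a)) (sym (ℤₚ.*-identityʳ b)) a≤b)

ι-homo-∣-∣ : ∀ a → ℚ.∣ ι a ∣ ≡ ι (+ ∣ a ∣)
ι-homo-∣-∣ a rewrite ι≡mkℚ a | ι≡mkℚ (+ ∣ a ∣) = refl

ι-≢0 : ∀ {a} → a ≢ + 0 → ι a ≢ 0ℚ
ι-≢0 a≢0 eq = a≢0 (ι-injective eq)

-- FracIntegral k q unfolds to Integral (ι (+ k) * q).
Integral : ℚ → Set
Integral q = ∃ λ z → q ≡ ι z

integral-ι : ∀ z → Integral (ι z)
integral-ι z = z , refl

integral-+ : ∀ {p q} → Integral p → Integral q → Integral (p + q)
integral-+ (a , refl) (b , refl) = a ℤ.+ b , sym (ι-homo-+ a b)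

integral-* : ∀ {p q} → Integral p → Integral q → Integral (p * q)
integral-* (a , refl) (b , refl) = a ℤ.* b , sym (ι-homo-* a b)

integral-- : ∀ {p q} → Integral p → Integral q → Integral (p - q)
integral-- ip (b , refl) = integral-+ ip (ℤ.- b , sym (ι-homo‿- b))

inv : (p : ℚ) → p ≢ 0ℚ → ℚ
inv p p≢0 = (1/ p) {{ℚ.≢-nonZero p≢0}}

*-inverseʳ : ∀ p (p≢0 : p ≢ 0ℚ) → p * inv p p≢0 ≡ 1ℚ
*-inverseʳ p p≢0 = ℚₚ.*-inverseʳ p {{ℚ.≢-nonZero p≢0}}

*-inverseˡ : ∀ p (p≢0 : p ≢ 0ℚ) → inv p p≢0 * p ≡ 1ℚ
*-inverseˡ p p≢0 = ℚₚ.*-inverseˡ p {{ℚ.≢-nonZero p≢0}}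

inv-≢0 : ∀ p (p≢0 : p ≢ 0ℚ) → inv p p≢0 ≢ 0ℚ
inv-≢0 p p≢0 eq = ℚₚ.1≢0 (trans (sym (*-inverseˡ p p≢0)) (trans (cong (_* p) eq) (ℚₚ.*-zeroˡ p)))

p*q≡0⇒p≡0 : ∀ p {q} → p * q ≡ 0ℚ → q ≢ 0ℚ → p ≡ 0ℚ
p*q≡0⇒p≡0 p {q} pq≡0 q≢0 = begin
  p                         ≡⟨ solve 1 (λ p → p := p :* con 1ℚ) refl p ⟩
  p * 1ℚ                    ≡⟨ cong (p *_) (sym (*-inverseʳ q q≢0)) ⟩
  p * (q * inv q q≢0)       ≡⟨ sym (ℚₚ.*-assoc p q _) ⟩
  (p * q) * inv q q≢0       ≡⟨ cong (_* inv q q≢0) pq≡0 ⟩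
  0ℚ * inv q q≢0            ≡⟨ ℚₚ.*-zeroˡ (inv q q≢0) ⟩
  0ℚ                        ∎
  where open ≡-Reasoning

*-≢0 : ∀ {p q} → p ≢ 0ℚ → q ≢ 0ℚ → p * q ≢ 0ℚ
*-≢0 {p} p≢0 q≢0 pq≡0 = p≢0 (p*q≡0⇒p≡0 p pq≡0 q≢0)

p-q≡0⇒p≡q : ∀ p q → p - q ≡ 0ℚ → p ≡ q
p-q≡0⇒p≡q = x∙y⁻¹≈ε⇒x≈y

p-[p*q⁻¹]*q≡0 : ∀ p q (q≢0 : q ≢ 0ℚ) → p - (p * inv q q≢0) * q ≡ 0ℚ
p-[p*q⁻¹]*q≡0 p q q≢0 = begin
  p - (p * inv q q≢0) * q   ≡⟨ cong (λ r → p - r) (ℚₚ.*-assoc p _ q) ⟩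
  p - p * (inv q q≢0 * q)   ≡⟨ cong (λ r → p - p * r) (*-inverseˡ q q≢0) ⟩
  p - p * 1ℚ                ≡⟨ solve 1 (λ p → p :- p :* con 1ℚ := con 0ℚ) refl p ⟩
  0ℚ                        ∎
  where open ≡-Reasoning

cross-multiply : ∀ x y x' y' (y≢0 : y ≢ 0ℚ) (y'≢0 : y' ≢ 0ℚ) →
                 x * y' ≡ x' * y → x * inv y y≢0 ≡ x' * inv y' y'≢0
cross-multiply x y x' y' y≢0 y'≢0 eq = begin
  x * iy                        ≡⟨ solve 2 (λ x iy → x :* iy := x :* iy :* con 1ℚ) refl x iy ⟩
  x * iy * 1ℚ                   ≡⟨ cong (x * iy *_) (sym (*-inverseʳ y' y'≢0)) ⟩
  x * iy * (y' * iy')           ≡⟨ solve 4 (λ x iy y' iy' → x :* iy :* (y' :* iy') := (x :* y') :* (iy :* iy')) refl x iy y' iy' ⟩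
  (x * y') * (iy * iy')         ≡⟨ cong (_* (iy * iy')) eq ⟩
  (x' * y) * (iy * iy')         ≡⟨ solve 4 (λ x' y iy iy' → (x' :* y) :* (iy :* iy') := x' :* iy' :* (y :* iy)) refl x' y iy iy' ⟩
  x' * iy' * (y * iy)           ≡⟨ cong (x' * iy' *_) (*-inverseʳ y y≢0) ⟩
  x' * iy' * 1ℚ                 ≡⟨ ℚₚ.*-identityʳ _ ⟩
  x' * iy'                      ∎
  where
  open ≡-Reasoning
  iy = inv y y≢0
  iy' = inv y' y'≢0

integral-ratio⇒∣ : ∀ k a b (ιb≢0 : ι b ≢ 0ℚ) → Integral (ι (+ k) * (ι a * inv (ι b) ιb≢0)) → ∣ b ∣ ∣ k ℕ.* ∣ a ∣
integral-ratio⇒∣ k a b ιb≢0 (z , k*a/b≡z) = divides ∣ z ∣ (begin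
  k ℕ.* ∣ a ∣         ≡⟨ ℤₚ.abs-* (+ k) a ⟨
  ∣ + k ℤ.* a ∣       ≡⟨ cong ∣_∣ (ι-injective {+ k ℤ.* a} {z ℤ.* b} ι[k*a]≡ι[z*b]) ⟩
  ∣ z ℤ.* b ∣         ≡⟨ ℤₚ.abs-* z b ⟩
  ∣ z ∣ ℕ.* ∣ b ∣     ∎)
  where
  open ≡-Reasoning
  ib = inv (ι b) ιb≢0
  ι[k*a]≡ι[z*b] : ι (+ k ℤ.* a) ≡ ι (z ℤ.* b)
  ι[k*a]≡ι[z*b] = begin
    ι (+ k ℤ.* a)                      ≡⟨ ι-homo-* (+ k) a ⟩
    ι (+ k) * ι a                      ≡⟨ ℚₚ.*-identityʳ _ ⟨
    (ι (+ k) * ι a) * 1ℚ               ≡⟨ cong ((ι (+ k) * ι a) *_) (*-inverseˡ (ι b) ιb≢0) ⟨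
    (ι (+ k) * ι a) * (ib * ι b)       ≡⟨ solve 4 (λ k a i b → (k :* a) :* (i :* b) := (k :* (a :* i)) :* b) refl (ι (+ k)) (ι a) ib (ι b) ⟩
    (ι (+ k) * (ι a * ib)) * ι b       ≡⟨ cong (_* ι b) k*a/b≡z ⟩
    ι z * ι b                          ≡⟨ ι-homo-* z b ⟨
    ι (z ℤ.* b)                        ∎

p≤q⇒0≤q-p : ∀ {p q} → p ℚ.≤ q → 0ℚ ℚ.≤ q - p
p≤q⇒0≤q-p {p} {q} p≤q = subst (ℚ._≤ q - p) (ℚₚ.+-inverseʳ p) (ℚₚ.+-monoˡ-≤ (- p) p≤q)

0≤-p⇒p≤0 : ∀ {p} → 0ℚ ℚ.≤ - p → p ℚ.≤ 0ℚ
0≤-p⇒p≤0 {p} 0≤-p = subst (ℚ._≤ 0ℚ) (solve 1 (λ p → :- (:- p) := p) refl p) (ℚₚ.neg-antimono-≤ 0≤-p)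

0≤0+p∧0≤0-p⇒p≡0 : ∀ {p} → 0ℚ ℚ.≤ 0ℚ + p → 0ℚ ℚ.≤ 0ℚ - p → p ≡ 0ℚ
0≤0+p∧0≤0-p⇒p≡0 {p} 0≤p 0≤-p = ℚₚ.≤-antisym
  (0≤-p⇒p≤0 (subst (0ℚ ℚ.≤_) (ℚₚ.+-identityˡ (- p)) 0≤-p))
  (subst (0ℚ ℚ.≤_) (ℚₚ.+-identityˡ p) 0≤p)

p≤∣p∣ : ∀ p → p ℚ.≤ ℚ.∣ p ∣
p≤∣p∣ p with ℚₚ.∣p∣≡p∨∣p∣≡-p p
... | inj₁ ∣p∣≡p  = ℚₚ.≤-reflexive (sym ∣p∣≡p)
... | inj₂ ∣p∣≡-p = ℚₚ.≤-trans (0≤-p⇒p≤0 (subst (0ℚ ℚ.≤_) ∣p∣≡-p (ℚₚ.0≤∣p∣ p))) (ℚₚ.0≤∣p∣ p)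

∣p∣≤q⇒0≤q±p : ∀ p q → ℚ.∣ p ∣ ℚ.≤ q → 0ℚ ℚ.≤ q + p × 0ℚ ℚ.≤ q - p
∣p∣≤q⇒0≤q±p p q ∣p∣≤q = 0≤q+p , p≤q⇒0≤q-p (ℚₚ.≤-trans (p≤∣p∣ p) ∣p∣≤q)
  where
  -p≤q : - p ℚ.≤ q
  -p≤q = ℚₚ.≤-trans (subst (- p ℚ.≤_) (ℚₚ.∣-p∣≡∣p∣ p) (p≤∣p∣ (- p))) ∣p∣≤q
  0≤q+p : 0ℚ ℚ.≤ q + p
  0≤q+p = subst (0ℚ ℚ.≤_) (cong (λ r → q + r) (solve 1 (λ p → :- (:- p) := p) refl p)) (p≤q⇒0≤q-p -p≤q)

ι-ratio≤∣numerator∣ : ∀ a b (ιb≢0 : ι b ≢ 0ℚ) → ι a * inv (ι b) ιb≢0 ℚ.≤ ι (+ ∣ a ∣)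
ι-ratio≤∣numerator∣ a b ιb≢0 = begin
  q                           ≤⟨ p≤∣p∣ q ⟩
  ℚ.∣ q ∣                     ≡⟨ ℚₚ.*-identityʳ ℚ.∣ q ∣ ⟨
  ℚ.∣ q ∣ * 1ℚ                ≤⟨ ℚₚ.*-monoˡ-≤-nonNeg ℚ.∣ q ∣ {{ℚₚ.∣-∣-nonNeg q}} 1≤∣b∣ ⟩
  ℚ.∣ q ∣ * ι (+ ∣ b ∣)       ≡⟨ cong (ℚ.∣ q ∣ *_) (ι-homo-∣-∣ b) ⟨
  ℚ.∣ q ∣ * ℚ.∣ ι b ∣         ≡⟨ ℚₚ.∣p*q∣≡∣p∣*∣q∣ q (ι b) ⟨
  ℚ.∣ q * ι b ∣               ≡⟨ cong ℚ.∣_∣ q*b≡a ⟩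
  ℚ.∣ ι a ∣                   ≡⟨ ι-homo-∣-∣ a ⟩
  ι (+ ∣ a ∣)                 ∎
  where
  open ℚₚ.≤-Reasoning
  q = ι a * inv (ι b) ιb≢0
  1≤∣b∣ : 1ℚ ℚ.≤ ι (+ ∣ b ∣)
  1≤∣b∣ = ι-mono-≤ {+ 1} {+ ∣ b ∣} (ℤ.+≤+ (ℕₚ.n≢0⇒n>0 (λ ∣b∣≡0 → ιb≢0 (cong ι (ℤₚ.∣i∣≡0⇒i≡0 {b} ∣b∣≡0)))))
  q*b≡a : q * ι b ≡ ι a
  q*b≡a = trans (ℚₚ.*-assoc (ι a) _ (ι b))
                (trans (cong (ι a *_) (*-inverseˡ (ι b) ιb≢0)) (ℚₚ.*-identityʳ (ι a)))

small-multiple₁ : ∀ {x a} → 0ℚ ℚ.≤ x → 0ℚ ℚ.≤ a → (x ≡ 0ℚ → a ≡ 0ℚ) → ∃ λ ε → 0ℚ ℚ.< ε × ε * a ℚ.≤ x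
small-multiple₁ {x} {a} 0≤x 0≤a x≡0⇒a≡0 with x ≟ 0ℚ
... | yes x≡0 = 1ℚ , ℚₚ.positive⁻¹ 1ℚ ,
                ℚₚ.≤-reflexive (trans (cong (1ℚ *_) (x≡0⇒a≡0 x≡0)) (trans (ℚₚ.*-zeroʳ 1ℚ) (sym x≡0)))
... | no x≢0 = ε , 0<ε , ε*a≤x
  where
  instance
    x>0 : ℚ.Positive x
    x>0 = ℚₚ.nonNeg∧nonZero⇒pos x {{ℚ.nonNegative 0≤x}} {{ℚ.≢-nonZero x≢0}}
    1+a>0 : ℚ.Positive (1ℚ + a)
    1+a>0 = ℚₚ.pos+nonNeg⇒pos 1ℚ a {{ℚ.nonNegative 0≤a}}
  1+a≢0 : 1ℚ + a ≢ 0ℚ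
  1+a≢0 = ℚₚ.<⇒≢ (ℚₚ.positive⁻¹ (1ℚ + a)) ∘ sym
  r = inv (1ℚ + a) 1+a≢0
  ε = x * r
  0<ε : 0ℚ ℚ.< ε
  0<ε = ℚₚ.positive⁻¹ ε {{ℚₚ.pos*pos⇒pos x r {{ℚₚ.1/pos⇒pos (1ℚ + a)}}}}
  x≡ε*a+ε : x ≡ ε * a + ε
  x≡ε*a+ε = begin
    x                   ≡⟨ ℚₚ.*-identityʳ x ⟨
    x * 1ℚ              ≡⟨ cong (x *_) (*-inverseˡ (1ℚ + a) 1+a≢0) ⟨
    x * (r * (1ℚ + a))  ≡⟨ solve 3 (λ x r a → x :* (r :* (con 1ℚ :+ a)) := (x :* r) :* a :+ x :* r) refl x r a ⟩
    ε * a + ε           ∎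
    where open ≡-Reasoning
  ε*a≤x : ε * a ℚ.≤ x
  ε*a≤x = subst (ε * a ℚ.≤_) (sym x≡ε*a+ε)
                (subst (ℚ._≤ ε * a + ε) (ℚₚ.+-identityʳ (ε * a)) (ℚₚ.+-monoʳ-≤ (ε * a) (ℚₚ.<⇒≤ 0<ε)))

small-multiple : ∀ {n} (x h : Vecℚ n) → (∀ i → 0ℚ ℚ.≤ x i) → (∀ i → x i ≡ 0ℚ → h i ≡ 0ℚ) →
                 ∃ λ ε → 0ℚ ℚ.< ε × (∀ i → ε * ℚ.∣ h i ∣ ℚ.≤ x i)
small-multiple {zero} x h _ _ = 1ℚ , ℚₚ.positive⁻¹ 1ℚ , λ ()
small-multiple {suc n} x h 0≤x supp⊆
  with small-multiple₁ (0≤x zero) (ℚₚ.0≤∣p∣ (h zero)) (cong ℚ.∣_∣ ∘ supp⊆ zero)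
     | small-multiple (x ∘ suc) (h ∘ suc) (0≤x ∘ suc) (supp⊆ ∘ suc)
... | ε₀ , 0<ε₀ , ε₀h≤x | ε₁ , 0<ε₁ , ε₁h≤x = ε₀ ℚ.⊓ ε₁ , 0<ε₀⊓ε₁ , bound
  where
  shrink : ∀ {ε ε′} i → ε′ ℚ.≤ ε → ε * ℚ.∣ h i ∣ ℚ.≤ x i → ε′ * ℚ.∣ h i ∣ ℚ.≤ x i
  shrink i ε′≤ε εh≤x = ℚₚ.≤-trans (ℚₚ.*-monoʳ-≤-nonNeg ℚ.∣ h i ∣ {{ℚₚ.∣-∣-nonNeg (h i)}} ε′≤ε) εh≤x
  0<ε₀⊓ε₁ : 0ℚ ℚ.< ε₀ ℚ.⊓ ε₁
  0<ε₀⊓ε₁ with ℚₚ.⊓-sel ε₀ ε₁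
  ... | inj₁ eq = subst (0ℚ ℚ.<_) (sym eq) 0<ε₀
  ... | inj₂ eq = subst (0ℚ ℚ.<_) (sym eq) 0<ε₁
  bound : ∀ i → (ε₀ ℚ.⊓ ε₁) * ℚ.∣ h i ∣ ℚ.≤ x i
  bound zero    = shrink zero (ℚₚ.p⊓q≤p ε₀ ε₁) ε₀h≤x
  bound (suc i) = shrink (suc i) (ℚₚ.p⊓q≤q ε₀ ε₁) (ε₁h≤x i)

perturbation : ∀ {n} (x h : Vecℚ n) → (∀ i → 0ℚ ℚ.≤ x i) → (∀ i → x i ≡ 0ℚ → h i ≡ 0ℚ) →
               ∃ λ ε → ε ≢ 0ℚ × (∀ i → 0ℚ ℚ.≤ x i + ε * h i × 0ℚ ℚ.≤ x i - ε * h i)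
perturbation x h 0≤x supp⊆ with small-multiple x h 0≤x supp⊆
... | ε , 0<ε , εh≤x = ε , ℚₚ.<⇒≢ 0<ε ∘ sym , λ i →
  ∣p∣≤q⇒0≤q±p (ε * h i) (x i) (subst (ℚ._≤ x i) (sym (∣εh∣≡ε∣h∣ i)) (εh≤x i))
  where
  ∣εh∣≡ε∣h∣ : ∀ i → ℚ.∣ ε * h i ∣ ≡ ε * ℚ.∣ h i ∣
  ∣εh∣≡ε∣h∣ i = trans (ℚₚ.∣p*q∣≡∣p∣*∣q∣ ε (h i)) (cong (_* ℚ.∣ h i ∣) (ℚₚ.0≤p⇒∣p∣≡p (ℚₚ.<⇒≤ 0<ε)))

-- gcd and lcm of finite families, primitive vectors

gcdFin : ∀ {k} → (Fin k → ℕ) → ℕ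
gcdFin {zero}  f = 0
gcdFin {suc k} f = gcd (f zero) (gcdFin (f ∘ suc))

gcdFin∣ : ∀ {k} (f : Fin k → ℕ) i → gcdFin f ∣ f i
gcdFin∣ {suc k} f zero    = gcd[m,n]∣m (f zero) (gcdFin (f ∘ suc))
gcdFin∣ {suc k} f (suc i) = ∣-trans (gcd[m,n]∣n (f zero) (gcdFin (f ∘ suc))) (gcdFin∣ (f ∘ suc) i)

gcdFin-greatest : ∀ {k} (f : Fin k → ℕ) {c} → (∀ i → c ∣ f i) → c ∣ gcdFin f
gcdFin-greatest {zero}  f c∣f = divides 0 refl
gcdFin-greatest {suc k} f c∣f = gcd-greatest (c∣f zero) (gcdFin-greatest (f ∘ suc) (c∣f ∘ suc))

c*gcdFin[f]≡gcdFin[c*f] : ∀ {k} c (f : Fin k → ℕ) → c ℕ.* gcdFin f ≡ gcdFin (λ i → c ℕ.* f i)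
c*gcdFin[f]≡gcdFin[c*f] {zero}  c f = ℕₚ.*-zeroʳ c
c*gcdFin[f]≡gcdFin[c*f] {suc k} c f =
  trans (c*gcd[m,n]≡gcd[cm,cn] c (f zero) _) (cong (gcd (c ℕ.* f zero)) (c*gcdFin[f]≡gcdFin[c*f] c (f ∘ suc)))

lcm≢0 : ∀ {a b} → a ≢ 0 → b ≢ 0 → lcm a b ≢ 0
lcm≢0 {a} {b} a≢0 b≢0 lcm≡0 with ℕₚ.m*n≡0⇒m≡0∨n≡0 a {b} (begin
  a ℕ.* b                ≡⟨ gcd*lcm a b ⟨
  gcd a b ℕ.* lcm a b    ≡⟨ cong (gcd a b ℕ.*_) lcm≡0 ⟩
  gcd a b ℕ.* 0          ≡⟨ ℕₚ.*-zeroʳ (gcd a b) ⟩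
  0                      ∎)
  where open ≡-Reasoning
... | inj₁ a≡0 = a≢0 a≡0
... | inj₂ b≡0 = b≢0 b≡0

lcmFin : ∀ {k} → (Fin k → ℕ) → ℕ
lcmFin {zero}  f = 1
lcmFin {suc k} f = lcm (f zero) (lcmFin (f ∘ suc))

∣lcmFin : ∀ {k} (f : Fin k → ℕ) i → f i ∣ lcmFin f
∣lcmFin {suc k} f zero    = m∣lcm[m,n] (f zero) (lcmFin (f ∘ suc))
∣lcmFin {suc k} f (suc i) = ∣-trans (∣lcmFin (f ∘ suc) i) (n∣lcm[m,n] (f zero) (lcmFin (f ∘ suc)))

lcmFin-least : ∀ {k} (f : Fin k → ℕ) {c} → (∀ i → f i ∣ c) → lcmFin f ∣ c
lcmFin-least {zero}  f {c} f∣c = divides c (sym (ℕₚ.*-identityʳ c))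
lcmFin-least {suc k} f f∣c = lcm-least (f∣c zero) (lcmFin-least (f ∘ suc) (f∣c ∘ suc))

lcmFin≢0 : ∀ {k} (f : Fin k → ℕ) → (∀ i → f i ≢ 0) → lcmFin f ≢ 0
lcmFin≢0 {zero}  f f≢0 ()
lcmFin≢0 {suc k} f f≢0 = lcm≢0 (f≢0 zero) (lcmFin≢0 (f ∘ suc) (f≢0 ∘ suc))

lcmSubset : ∀ {n} → (Subset n → ℕ) → ℕ
lcmSubset {zero}  f = f []
lcmSubset {suc n} f = lcm (lcmSubset (f ∘ (inside ∷_))) (lcmSubset (f ∘ (outside ∷_)))

∣lcmSubset : ∀ {n} (f : Subset n → ℕ) C → f C ∣ lcmSubset f
∣lcmSubset {zero}  f []          = ∣-refl
∣lcmSubset {suc n} f (true ∷ C)  =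
  ∣-trans (∣lcmSubset (f ∘ (inside ∷_)) C) (m∣lcm[m,n] _ (lcmSubset (f ∘ (outside ∷_))))
∣lcmSubset {suc n} f (false ∷ C) =
  ∣-trans (∣lcmSubset (f ∘ (outside ∷_)) C) (n∣lcm[m,n] (lcmSubset (f ∘ (inside ∷_))) _)

lcmSubset-least : ∀ {n} (f : Subset n → ℕ) {c} → (∀ C → f C ∣ c) → lcmSubset f ∣ c
lcmSubset-least {zero}  f f∣c = f∣c []
lcmSubset-least {suc n} f f∣c =
  lcm-least (lcmSubset-least (f ∘ (inside ∷_)) (f∣c ∘ (inside ∷_)))
            (lcmSubset-least (f ∘ (outside ∷_)) (f∣c ∘ (outside ∷_)))

lcmSubset≢0 : ∀ {n} (f : Subset n → ℕ) → (∀ C → f C ≢ 0) → lcmSubset f ≢ 0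
lcmSubset≢0 {zero}  f f≢0 = f≢0 []
lcmSubset≢0 {suc n} f f≢0 =
  lcm≢0 (lcmSubset≢0 (f ∘ (inside ∷_)) (f≢0 ∘ (inside ∷_)))
        (lcmSubset≢0 (f ∘ (outside ∷_)) (f≢0 ∘ (outside ∷_)))

primitive-∣ : ∀ {n} {a k} (g : Fin n → ℤ) → Primitive g → (∀ l → a ∣ k ℕ.* ∣ g l ∣) → a ∣ k
primitive-∣ {a = a} {k} g g-prim a∣kg = subst (a ∣_) k*gcd≡k
  (subst (a ∣_) (sym (c*gcdFin[f]≡gcdFin[c*f] k (∣_∣ ∘ g))) (gcdFin-greatest _ a∣kg))
  where
  k*gcd≡k : k ℕ.* gcdFin (∣_∣ ∘ g) ≡ k
  k*gcd≡k = trans (cong (k ℕ.*_) (∣1⇒≡1 (g-prim _ (gcdFin∣ (∣_∣ ∘ g))))) (ℕₚ.*-identityʳ k)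

primitive-proportional⇒∣≡∣ : ∀ {n} (g h : Fin n → ℤ) → Primitive g → Primitive h →
                             ∀ i → (∀ l → g l ℤ.* h i ≡ h l ℤ.* g i) → ∣ g i ∣ ≡ ∣ h i ∣
primitive-proportional⇒∣≡∣ g h g-prim h-prim i cross =
  ∣-antisym (∣gᵢ∣∣∣hᵢ∣ g h g-prim cross) (∣gᵢ∣∣∣hᵢ∣ h g h-prim (sym ∘ cross))
  where
  ∣gᵢ∣∣∣hᵢ∣ : ∀ g h → Primitive g → (∀ l → g l ℤ.* h i ≡ h l ℤ.* g i) → ∣ g i ∣ ∣ ∣ h i ∣
  ∣gᵢ∣∣∣hᵢ∣ g h g-prim cross = primitive-∣ g g-prim λ l → subst (∣ g i ∣ ∣_) (begin
    ∣ h l ∣ ℕ.* ∣ g i ∣     ≡⟨ ℤₚ.abs-* (h l) (g i) ⟨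
    ∣ h l ℤ.* g i ∣         ≡⟨ cong ∣_∣ (cross l) ⟨
    ∣ g l ℤ.* h i ∣         ≡⟨ ℤₚ.abs-* (g l) (h i) ⟩
    ∣ g l ∣ ℕ.* ∣ h i ∣     ≡⟨ ℕₚ.*-comm ∣ g l ∣ ∣ h i ∣ ⟩
    ∣ h i ∣ ℕ.* ∣ g l ∣     ∎) (n∣m*n ∣ h l ∣)
    where open ≡-Reasoning

primitive-part : ∀ {n} (z : Fin n → ℤ) {j} → z j ≢ + 0 →
                 ∃ λ G → ∃ λ (g : Fin n → ℤ) → G ≢ 0 × Primitive g × (∀ i → z i ≡ g i ℤ.* + G)
primitive-part z {j} zⱼ≢0 = G , g , G≢0 , g-prim , z≡g*G
  where
  G = gcdFin (∣_∣ ∘ z)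
  G≢0 : G ≢ 0
  G≢0 G≡0 = zⱼ≢0 (ℤₚ.∣i∣≡0⇒i≡0 (0∣⇒≡0 (subst (_∣ ∣ z j ∣) G≡0 (gcdFin∣ (∣_∣ ∘ z) j))))
  G∣z : ∀ i → + G ℤ∣.∣ z i
  G∣z i = ℤ∣.∣ᵤ⇒∣ (gcdFin∣ (∣_∣ ∘ z) i)
  g : Fin _ → ℤ
  g i = ℤ∣.quotient (G∣z i)
  z≡g*G : ∀ i → z i ≡ g i ℤ.* + G
  z≡g*G i = ℤ∣._∣_.equality (G∣z i)
  g-prim : Primitive g
  g-prim d d∣g = *-cancelʳ-∣ G {{ℕ.≢-nonZero G≢0}} (subst (d ℕ.* G ∣_) (sym (ℕₚ.*-identityˡ G)) dG∣G)
    where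
    dG∣G : d ℕ.* G ∣ G
    dG∣G = gcdFin-greatest (∣_∣ ∘ z) λ i →
      subst (d ℕ.* G ∣_) (sym (trans (cong ∣_∣ (z≡g*G i)) (ℤₚ.abs-* (g i) (+ G)))) (*-monoˡ-∣ G (d∣g i))

↧*q-integral : ∀ q → Integral (ι (+ ↧ₙ q) * q)
↧*q-integral q@(mkℚ a d _) = a , (begin
  ι (+ suc d) * q         ≡⟨ cong (_* q) (ι≡mkℚ (+ suc d)) ⟩
  ℚ.fromℚᵘ [d*a]/[d+0]    ≡⟨ ℚₚ.fromℚᵘ-cong {[d*a]/[d+0]} {ℚᵘ.mkℚᵘ a 0} (ℚᵘ.*≡* d*a≡a*d) ⟩
  ℚ.fromℚᵘ (ℚᵘ.mkℚᵘ a 0)  ∎)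
  where
  open ≡-Reasoning
  [d*a]/[d+0] = ℚᵘ.mkℚᵘ (+ suc d ℤ.* a) (d ℕ.+ 0)
  d*a≡a*d : (+ suc d ℤ.* a) ℤ.* + 1 ≡ a ℤ.* + suc (d ℕ.+ 0)
  d*a≡a*d = trans (ℤₚ.*-identityʳ _)
                  (trans (ℤₚ.*-comm (+ suc d) a) (cong (λ k → a ℤ.* + suc k) (sym (ℕₚ.+-identityʳ d))))

common-denominator : ∀ {n} (u : Vecℚ n) → ∃ λ P → P ≢ 0 × (∀ i → Integral (ι (+ P) * u i))
common-denominator {zero}  u = 1 , (λ ()) , λ ()
common-denominator {suc n} u with common-denominator (u ∘ suc)
... | P , P≢0 , Pu-integral = D ℕ.* P , D*P≢0 , DPu-integral
  where
  D = ↧ₙ (u zero)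
  D*P≢0 : D ℕ.* P ≢ 0
  D*P≢0 DP≡0 with ℕₚ.m*n≡0⇒m≡0∨n≡0 D DP≡0
  ... | inj₁ ()
  ... | inj₂ P≡0 = P≢0 P≡0
  ι[D*P] : ι (+ (D ℕ.* P)) ≡ ι (+ D) * ι (+ P)
  ι[D*P] = trans (cong ι (ℤₚ.pos-* D P)) (ι-homo-* (+ D) (+ P))
  DPu-integral : ∀ i → Integral (ι (+ (D ℕ.* P)) * u i)
  DPu-integral zero = subst Integral
    (sym (trans (cong (_* u zero) ι[D*P])
                (solve 3 (λ d p u → (d :* p) :* u := p :* (d :* u)) refl (ι (+ D)) (ι (+ P)) (u zero))))
    (integral-* (integral-ι (+ P)) (↧*q-integral (u zero)))
  DPu-integral (suc i) = subst Integral
    (sym (trans (cong (_* u (suc i)) ι[D*P]) (ℚₚ.*-assoc (ι (+ D)) (ι (+ P)) (u (suc i)))))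
    (integral-* (integral-ι (+ D)) (Pu-integral i))

record PrimitiveMultiple {n} (u : Vecℚ n) : Set where
  field
    vector         : Fin n → ℤ
    scale          : ℚ
    scale≢0        : scale ≢ 0ℚ
    vector≡scale*u : ∀ i → ι (vector i) ≡ scale * u i
    isPrimitive    : Primitive vector

primitiveMultiple : ∀ {n} (u : Vecℚ n) {j} → u j ≢ 0ℚ → PrimitiveMultiple u
primitiveMultiple {n} u {j} uⱼ≢0 with common-denominator u
... | P , P≢0 , Pu-integral = fromPrimitivePart (primitive-part z zⱼ≢0)
  where
  z : Fin n → ℤ
  z = proj₁ ∘ Pu-integral
  ιP≢0 : ι (+ P) ≢ 0ℚ
  ιP≢0 = ι-≢0 (P≢0 ∘ ℤₚ.+-injective)
  zⱼ≢0 : z j ≢ + 0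
  zⱼ≢0 zⱼ≡0 = *-≢0 ιP≢0 uⱼ≢0 (trans (proj₂ (Pu-integral j)) (cong ι zⱼ≡0))
  fromPrimitivePart : (∃ λ G → ∃ λ g → G ≢ 0 × Primitive g × (∀ i → z i ≡ g i ℤ.* + G)) → PrimitiveMultiple u
  fromPrimitivePart (G , g , G≢0 , g-prim , z≡g*G) = record
    { vector = g ; scale = ι (+ P) * iG ; scale≢0 = *-≢0 ιP≢0 (inv-≢0 ιG ιG≢0)
    ; vector≡scale*u = g≡scale*u ; isPrimitive = g-prim }
    where
    ιG = ι (+ G)
    ιG≢0 : ιG ≢ 0ℚ
    ιG≢0 = ι-≢0 (G≢0 ∘ ℤₚ.+-injective)
    iG = inv ιG ιG≢0
    g≡scale*u : ∀ i → ι (g i) ≡ (ι (+ P) * iG) * u i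
    g≡scale*u i = begin
      ι (g i)               ≡⟨ ℚₚ.*-identityʳ (ι (g i)) ⟨
      ι (g i) * 1ℚ          ≡⟨ cong (ι (g i) *_) (*-inverseʳ ιG ιG≢0) ⟨
      ι (g i) * (ιG * iG)   ≡⟨ ℚₚ.*-assoc (ι (g i)) ιG iG ⟨
      (ι (g i) * ιG) * iG   ≡⟨ cong (_* iG) (trans (cong ι (z≡g*G i)) (ι-homo-* (g i) (+ G))) ⟨
      ι (z i) * iG          ≡⟨ cong (_* iG) (proj₂ (Pu-integral i)) ⟨
      (ι (+ P) * u i) * iG  ≡⟨ solve 3 (λ p u g → (p :* u) :* g := (p :* g) :* u) refl (ι (+ P)) (u i) iG ⟩
      (ι (+ P) * iG) * u i  ∎
      where open ≡-Reasoning

-- Supports, spans and Gaussian elimination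

module _ {n : ℕ} where

  IsZero : Vecℚ n → Set
  IsZero v = ∀ i → v i ≡ 0ℚ

  isZero? : ∀ v → Dec (IsZero v)
  isZero? v = Finₚ.all? (λ i → v i ≟ 0ℚ)

  Vanishes : List (Fin n) → Vecℚ n → Set
  Vanishes ts v = All (λ t → v t ≡ 0ℚ) ts

  ∈-supp⁻ : ∀ (x : Vecℚ n) {i} → i ∈ supp x → x i ≢ 0ℚ
  ∈-supp⁻ x {i} i∈supp xᵢ≡0 =
    outside-if-≡0 (x i ≟ 0ℚ) (trans (sym (Vecₚ.lookup∘tabulate _ i)) (Vecₚ.[]=⇒lookup i∈supp))
    where
    outside-if-≡0 : (d : Dec (x i ≡ 0ℚ)) → (if does d then outside else inside) ≢ inside
    outside-if-≡0 (yes _)     ()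
    outside-if-≡0 (no xᵢ≢0) _ = xᵢ≢0 xᵢ≡0

  ∈-supp⁺ : ∀ (x : Vecℚ n) {i} → x i ≢ 0ℚ → i ∈ supp x
  ∈-supp⁺ x {i} xᵢ≢0 = Vecₚ.lookup⇒[]= i (supp x) (trans (Vecₚ.lookup∘tabulate _ i) (inside-if-≢0 (x i ≟ 0ℚ)))
    where
    inside-if-≢0 : (d : Dec (x i ≡ 0ℚ)) → (if does d then outside else inside) ≡ inside
    inside-if-≢0 (yes xᵢ≡0) = ⊥-elim (xᵢ≢0 xᵢ≡0)
    inside-if-≢0 (no _)     = refl

  ∉-supp⁻ : ∀ (x : Vecℚ n) {i} → i ∉ supp x → x i ≡ 0ℚ
  ∉-supp⁻ x {i} i∉supp = decidable-stable (x i ≟ 0ℚ) (i∉supp ∘ ∈-supp⁺ x)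

  supp-⊆⁺ : ∀ (x y : Vecℚ n) → (∀ i → x i ≡ 0ℚ → y i ≡ 0ℚ) → supp y ⊆ supp x
  supp-⊆⁺ x y zeros i∈supp = ∈-supp⁺ x (∈-supp⁻ y i∈supp ∘ zeros _)

  supp-⊆⁻ : ∀ (x y : Vecℚ n) → supp y ⊆ supp x → ∀ i → x i ≡ 0ℚ → y i ≡ 0ℚ
  supp-⊆⁻ x y y⊆x i xᵢ≡0 = ∉-supp⁻ y (λ i∈supp → ∈-supp⁻ x (y⊆x i∈supp) xᵢ≡0)

  _∉?_ : (i : Fin n) (C : Subset n) → Dec (i ∉ C)
  i ∉? C = ¬? (i ∈? C)

  outsideOf : Subset n → List (Fin n)
  outsideOf C = List.filter (_∉? C) (List.allFin n)

  vanishes-outside⇒supp⊆ : ∀ C (v : Vecℚ n) → Vanishes (outsideOf C) v → supp v ⊆ C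
  vanishes-outside⇒supp⊆ C v vanishes {i} i∈supp with i ∈? C
  ... | yes i∈C = i∈C
  ... | no i∉C  = ⊥-elim (∈-supp⁻ v i∈supp (All.lookup vanishes (∈-filter⁺ (_∉? C) (∈-allFin i) i∉C)))

  supp⊆⇒vanishes-outside : ∀ C (v : Vecℚ n) → supp v ⊆ C → Vanishes (outsideOf C) v
  supp⊆⇒vanishes-outside C v supp⊆C = All.tabulate λ t∈outside →
    ∉-supp⁻ v (proj₂ (∈-filter⁻ (_∉? C) {xs = List.allFin n} t∈outside) ∘ supp⊆C)

  nonzero⇒∃≢0 : ∀ (v : Vecℚ n) → NonZeroVec v → ∃ λ j → v j ≢ 0ℚ
  nonzero⇒∃≢0 v = Finₚ.¬∀⟶∃¬ n _ (λ i → v i ≟ 0ℚ)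

  supp-≗ : ∀ {x y : Vecℚ n} → x ≗ y → supp x ≡ supp y
  supp-≗ x≗y = Vecₚ.tabulate-cong λ i → cong (λ q → if does (q ≟ 0ℚ) then outside else inside) (x≗y i)

  supp-scale : ∀ (v : Vecℚ n) {s} → s ≢ 0ℚ → supp (λ i → s * v i) ≡ supp v
  supp-scale v {s} s≢0 = ⊆-antisym
    (supp-⊆⁺ v _ λ i vᵢ≡0 → trans (cong (s *_) vᵢ≡0) (ℚₚ.*-zeroʳ s))
    (supp-⊆⁺ _ v λ i svᵢ≡0 → p*q≡0⇒p≡0 (v i) (trans (ℚₚ.*-comm (v i) s) svᵢ≡0) s≢0)

  Span : List (Vecℚ n) → Vecℚ n → Set
  Span []      v = IsZero v
  Span (u ∷ L) v = ∃ λ c → Span L (λ i → v i - c * u i)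

  span-≗ : ∀ L {v w} → v ≗ w → Span L v → Span L w
  span-≗ []      v≗w v≡0 i       = trans (sym (v≗w i)) (v≡0 i)
  span-≗ (u ∷ L) v≗w (c , v-cu∈) = c , span-≗ L (λ i → cong (_- c * u i) (v≗w i)) v-cu∈

  span-0 : ∀ L → Span L (λ _ → 0ℚ)
  span-0 []      i = refl
  span-0 (u ∷ L)   = 0ℚ , span-≗ L (λ i → solve 1 (λ u → con 0ℚ := con 0ℚ :- con 0ℚ :* u) refl (u i)) (span-0 L)

  span-+ : ∀ L {v w} → Span L v → Span L w → Span L (λ i → v i + w i)
  span-+ []      v≡0 w≡0 i rewrite v≡0 i | w≡0 i = refl
  span-+ (u ∷ L) {v} {w} (c , v-cu∈) (d , w-du∈) = c + d , span-≗ L (λ i → regroup (v i) (w i) c d (u i)) (span-+ L v-cu∈ w-du∈)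
    where
    regroup : ∀ v w c d u → (v - c * u) + (w - d * u) ≡ (v + w) - (c + d) * u
    regroup = solve 5 (λ v w c d u → (v :- c :* u) :+ (w :- d :* u) := (v :+ w) :- (c :+ d) :* u) refl

  span-* : ∀ L a {v} → Span L v → Span L (λ i → a * v i)
  span-* []      a v≡0 i rewrite v≡0 i = ℚₚ.*-zeroʳ a
  span-* (u ∷ L) a {v} (c , v-cu∈) = a * c , span-≗ L (λ i → distrib a (v i) c (u i)) (span-* L a v-cu∈)
    where
    distrib : ∀ a v c u → a * (v - c * u) ≡ a * v - (a * c) * u
    distrib = solve 4 (λ a v c u → a :* (v :- c :* u) := a :* v :- (a :* c) :* u) refl

  span-head : ∀ u L → Span (u ∷ L) u
  span-head u L = 1ℚ , span-≗ L (λ i → solve 1 (λ u → con 0ℚ := u :- con 1ℚ :* u) refl (u i)) (span-0 L)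

  nonzero-in-span? : ∀ L → Dec (∃ λ v → Span L v × NonZeroVec v)
  nonzero-in-span? []      = no λ (v , v≡0 , v≢0) → v≢0 v≡0
  nonzero-in-span? (u ∷ L) with isZero? u
  ... | no u≢0  = yes (u , span-head u L , u≢0)
  ... | yes u≡0 = map′ (λ (v , v∈ , v≢0) → v , (0ℚ , span-≗ L (v≡v-c*u 0ℚ v) v∈) , v≢0)
                       (λ (v , (c , v-cu∈) , v≢0) → v , span-≗ L (sym ∘ v≡v-c*u c v) v-cu∈ , v≢0)
                       (nonzero-in-span? L)
    where
    v≡v-c*u : ∀ c (v : Vecℚ n) i → v i ≡ v i - c * u i
    v≡v-c*u c v i = begin
      v i              ≡⟨ solve 2 (λ v c → v := v :- c :* con 0ℚ) refl (v i) c ⟩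
      v i - c * 0ℚ     ≡⟨ cong (λ r → v i - c * r) (u≡0 i) ⟨
      v i - c * u i    ∎
      where open ≡-Reasoning

  span-vanishes : ∀ j L → All (λ w → w j ≡ 0ℚ) L → ∀ {v} → Span L v → v j ≡ 0ℚ
  span-vanishes j []      []                v≡0               = v≡0 j
  span-vanishes j (u ∷ L) (uⱼ≡0 ∷ Lⱼ≡0) {v} (c , v-cu∈) = begin
    v j                         ≡⟨ solve 2 (λ v cu → v := (v :- cu) :+ cu) refl (v j) (c * u j) ⟩
    (v j - c * u j) + c * u j   ≡⟨ cong₂ (λ a b → a + c * b) (span-vanishes j L Lⱼ≡0 v-cu∈) uⱼ≡0 ⟩
    0ℚ + c * 0ℚ                 ≡⟨ solve 1 (λ c → con 0ℚ :+ c :* con 0ℚ := con 0ℚ) refl c ⟩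
    0ℚ                          ∎
    where open ≡-Reasoning

  pivot : (j : Fin n) (u : Vecℚ n) → u j ≢ 0ℚ → Vecℚ n → Vecℚ n
  pivot j u uⱼ≢0 w i = w i - (w j * inv (u j) uⱼ≢0) * u i

  module _ (j : Fin n) (u : Vecℚ n) (uⱼ≢0 : u j ≢ 0ℚ) where

    private
      r : ℚ
      r = inv (u j) uⱼ≢0
      α : Vecℚ n → ℚ
      α w = w j * r

    pivot-vanishes : ∀ w → pivot j u uⱼ≢0 w j ≡ 0ℚ
    pivot-vanishes w = p-[p*q⁻¹]*q≡0 (w j) (u j) uⱼ≢0

    span-map-pivot⁺ : ∀ L {w} → Span L w → Span (List.map (pivot j u uⱼ≢0) L) (pivot j u uⱼ≢0 w)
    span-map-pivot⁺ []       {w} w≡0 i = begin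
      w i - (w j * r) * u i    ≡⟨ cong₂ (λ a b → a - (b * r) * u i) (w≡0 i) (w≡0 j) ⟩
      0ℚ - (0ℚ * r) * u i      ≡⟨ solve 2 (λ r uᵢ → con 0ℚ :- (con 0ℚ :* r) :* uᵢ := con 0ℚ) refl r (u i) ⟩
      0ℚ                       ∎
      where open ≡-Reasoning
    span-map-pivot⁺ (w′ ∷ L) {w} (c , w-cw′∈) =
      c , span-≗ (List.map (pivot j u uⱼ≢0) L) (λ i → linear (w i) (w j) (w′ i) (w′ j) (u i)) (span-map-pivot⁺ L w-cw′∈)
      where
      linear : ∀ wᵢ wⱼ w′ᵢ w′ⱼ uᵢ →
               (wᵢ - c * w′ᵢ) - ((wⱼ - c * w′ⱼ) * r) * uᵢ ≡ (wᵢ - (wⱼ * r) * uᵢ) - c * (w′ᵢ - (w′ⱼ * r) * uᵢ)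
      linear wᵢ wⱼ w′ᵢ w′ⱼ uᵢ = solve 7 (λ wᵢ wⱼ w′ᵢ w′ⱼ uᵢ c r →
        (wᵢ :- c :* w′ᵢ) :- ((wⱼ :- c :* w′ⱼ) :* r) :* uᵢ := (wᵢ :- (wⱼ :* r) :* uᵢ) :- c :* (w′ᵢ :- (w′ⱼ :* r) :* uᵢ))
        refl wᵢ wⱼ w′ᵢ w′ⱼ uᵢ c r

    span-map-pivot⁻ : ∀ L {v} → Span (List.map (pivot j u uⱼ≢0) L) v → Span (u ∷ L) v
    span-map-pivot⁻ []      {v} v≡0 = 0ℚ , λ i → cong₂ _-_ (v≡0 i) (ℚₚ.*-zeroˡ (u i))
    span-map-pivot⁻ (w ∷ L) {v} (c , v-c·pivot[w]∈) with span-map-pivot⁻ L v-c·pivot[w]∈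
    ... | t , rest∈ = t - c * α w , c , span-≗ L (λ i → regroup (v i) (w i) (u i) c t (α w)) rest∈
      where
      regroup : ∀ v w u c t a → (v - c * (w - a * u)) - t * u ≡ (v - (t - c * a) * u) - c * w
      regroup = solve 6 (λ v w u c t a → (v :- c :* (w :- a :* u)) :- t :* u := (v :- (t :- c :* a) :* u) :- c :* w) refl

    pivot-where-zero : ∀ w {t} → u t ≡ 0ℚ → pivot j u uⱼ≢0 w t ≡ w t
    pivot-where-zero w {t} uₜ≡0 = begin
      w t - α w * u t     ≡⟨ cong (λ a → w t - α w * a) uₜ≡0 ⟩
      w t - α w * 0ℚ      ≡⟨ solve 2 (λ w a → w :- a :* con 0ℚ := w) refl (w t) (α w) ⟩
      w t                 ∎
      where open ≡-Reasoning

    supp-pivot⊆ : ∀ {w} → supp w ⊆ supp u → supp (pivot j u uⱼ≢0 w) ⊆ supp u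
    supp-pivot⊆ {w} w⊆u = supp-⊆⁺ u _ λ i uᵢ≡0 → trans (pivot-where-zero w uᵢ≡0) (supp-⊆⁻ u w w⊆u i uᵢ≡0)

  eliminate : Fin n → List (Vecℚ n) → List (Vecℚ n)
  eliminate j []      = []
  eliminate j (u ∷ L) with u j ≟ 0ℚ
  ... | yes _   = u ∷ eliminate j L
  ... | no uⱼ≢0 = List.map (pivot j u uⱼ≢0) L

  span-eliminate⁻ : ∀ j L {v} → Span (eliminate j L) v → Span L v × v j ≡ 0ℚ
  span-eliminate⁻ j []      v≡0 = v≡0 , v≡0 j
  span-eliminate⁻ j (u ∷ L) {v} v∈ with u j ≟ 0ℚ | v∈
  ... | yes uⱼ≡0 | c , v-cu∈ with span-eliminate⁻ j L v-cu∈
  ...   | v-cu∈L , vⱼ-cuⱼ≡0 = (c , v-cu∈L) , (begin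
    v j                         ≡⟨ solve 2 (λ v cu → v := (v :- cu) :+ cu) refl (v j) (c * u j) ⟩
    (v j - c * u j) + c * u j   ≡⟨ cong₂ (λ a b → a + c * b) vⱼ-cuⱼ≡0 uⱼ≡0 ⟩
    0ℚ + c * 0ℚ                 ≡⟨ solve 1 (λ c → con 0ℚ :+ c :* con 0ℚ := con 0ℚ) refl c ⟩
    0ℚ                          ∎)
    where open ≡-Reasoning
  span-eliminate⁻ j (u ∷ L) {v} _ | no uⱼ≢0 | v∈ =
    span-map-pivot⁻ j u uⱼ≢0 L v∈ ,
    span-vanishes j (List.map (pivot j u uⱼ≢0) L) (Allₚ.map⁺ (All.tabulate λ {w} _ → pivot-vanishes j u uⱼ≢0 w)) v∈

  span-eliminate⁺ : ∀ j L {v} → Span L v → v j ≡ 0ℚ → Span (eliminate j L) v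
  span-eliminate⁺ j []      v≡0 _ = v≡0
  span-eliminate⁺ j (u ∷ L) {v} (c , v-cu∈) vⱼ≡0 with u j ≟ 0ℚ
  ... | yes uⱼ≡0 = c , span-eliminate⁺ j L v-cu∈ (begin
    v j - c * u j     ≡⟨ cong₂ (λ a b → a - c * b) vⱼ≡0 uⱼ≡0 ⟩
    0ℚ - c * 0ℚ       ≡⟨ solve 1 (λ c → con 0ℚ :- c :* con 0ℚ := con 0ℚ) refl c ⟩
    0ℚ                ∎)
    where open ≡-Reasoning
  ... | no uⱼ≢0 = span-≗ (List.map (pivot j u uⱼ≢0) L) pivot[v-cu]≗v (span-map-pivot⁺ j u uⱼ≢0 L v-cu∈)
    where
    r = inv (u j) uⱼ≢0
    pivot[v-cu]≗v : ∀ i → (v i - c * u i) - ((v j - c * u j) * r) * u i ≡ v i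
    pivot[v-cu]≗v i = begin
      (v i - c * u i) - ((v j - c * u j) * r) * u i  ≡⟨ cong (λ a → (v i - c * u i) - ((a - c * u j) * r) * u i) vⱼ≡0 ⟩
      (v i - c * u i) - ((0ℚ - c * u j) * r) * u i   ≡⟨ solve 5 (λ vᵢ uᵢ uⱼ c r →
          (vᵢ :- c :* uᵢ) :- ((con 0ℚ :- c :* uⱼ) :* r) :* uᵢ := vᵢ :- c :* uᵢ :+ c :* (uⱼ :* r) :* uᵢ)
          refl (v i) (u i) (u j) c r ⟩
      v i - c * u i + c * (u j * r) * u i            ≡⟨ cong (λ a → v i - c * u i + c * a * u i) (*-inverseʳ (u j) uⱼ≢0) ⟩
      v i - c * u i + c * 1ℚ * u i                   ≡⟨ solve 3 (λ vᵢ uᵢ c → vᵢ :- c :* uᵢ :+ c :* con 1ℚ :* uᵢ := vᵢ) refl (v i) (u i) c ⟩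
      v i                                            ∎
      where open ≡-Reasoning

  eliminateAll : List (Fin n) → List (Vecℚ n) → List (Vecℚ n)
  eliminateAll []       L = L
  eliminateAll (t ∷ ts) L = eliminateAll ts (eliminate t L)

  span-eliminateAll⁻ : ∀ ts L {v} → Span (eliminateAll ts L) v → Span L v × Vanishes ts v
  span-eliminateAll⁻ []       L v∈ = v∈ , []
  span-eliminateAll⁻ (t ∷ ts) L v∈ with span-eliminateAll⁻ ts (eliminate t L) v∈
  ... | v∈′ , vanishes with span-eliminate⁻ t L v∈′
  ...   | v∈L , vₜ≡0 = v∈L , vₜ≡0 ∷ vanishes

  span-eliminateAll⁺ : ∀ ts L {v} → Span L v → Vanishes ts v → Span (eliminateAll ts L) v
  span-eliminateAll⁺ []       L v∈ []                = v∈
  span-eliminateAll⁺ (t ∷ ts) L v∈ (vₜ≡0 ∷ vanishes) = span-eliminateAll⁺ ts (eliminate t L) (span-eliminate⁺ t L v∈ vₜ≡0) vanishes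

  nonzero-vanishing-in-span? : ∀ L ts → Dec (∃ λ v → Span L v × NonZeroVec v × Vanishes ts v)
  nonzero-vanishing-in-span? L ts = map′
    (λ (v , v∈ , v≢0) → v , proj₁ (span-eliminateAll⁻ ts L v∈) , v≢0 , proj₂ (span-eliminateAll⁻ ts L v∈))
    (λ (v , v∈ , v≢0 , vanishes) → v , span-eliminateAll⁺ ts L v∈ vanishes , v≢0)
    (nonzero-in-span? (eliminateAll ts L))

inSpan⇒span : ∀ {m n} (B : Fin m → Vecℚ n) {x} → InSpan B x → Span (List.tabulate B) x
inSpan⇒span {zero}  B (c , x≡0) = x≡0
inSpan⇒span {suc m} B {x} (c , x≡) = c zero , inSpan⇒span (B ∘ suc) (c ∘ suc , rest)
  where
  rest : ∀ i → x i - c zero * B zero i ≡ sumFin (λ j → c (suc j) * B (suc j) i)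
  rest i rewrite x≡ i = solve 2 (λ a s → (a :+ s) :- a := s) refl (c zero * B zero i) _

span⇒inSpan : ∀ {m n} (B : Fin m → Vecℚ n) {x} → Span (List.tabulate B) x → InSpan B x
span⇒inSpan {zero}  B x≡0 = (λ ()) , x≡0
span⇒inSpan {suc m} B {x} (c₀ , rest∈) with span⇒inSpan (B ∘ suc) rest∈
... | c , rest≡ = (λ { zero → c₀ ; (suc j) → c j }) , x≡
  where
  x≡ : ∀ i → x i ≡ c₀ * B zero i + sumFin (λ j → c j * B (suc j) i)
  x≡ i rewrite sym (rest≡ i) = solve 2 (λ x a → x := a :+ (x :- a)) refl (x i) (c₀ * B zero i)

-- Circuits and κ̇

module _ {m n : ℕ} (B : Fin m → Vecℚ n) where

  private
    W : Vecℚ n → Set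
    W = InSpan B

  W-≗ : ∀ {v w} → W v → v ≗ w → W w
  W-≗ v∈ v≗w = span⇒inSpan B (span-≗ _ v≗w (inSpan⇒span B v∈))

  W-+ : ∀ {v w} → W v → W w → W (λ i → v i + w i)
  W-+ v∈ w∈ = span⇒inSpan B (span-+ _ (inSpan⇒span B v∈) (inSpan⇒span B w∈))

  W-* : ∀ a {v} → W v → W (λ i → a * v i)
  W-* a v∈ = span⇒inSpan B (span-* _ a (inSpan⇒span B v∈))

  W-- : ∀ {v w} → W v → W w → W (λ i → v i - w i)
  W-- {v} {w} v∈ w∈ = W-≗ (W-+ v∈ (W-* (- 1ℚ) w∈)) (λ i → solve 2 (λ v w → v :+ (:- con 1ℚ) :* w := v :- w) refl (v i) (w i))

  W-pivot : ∀ {j u} (uⱼ≢0 : u j ≢ 0ℚ) {w} → W u → W w → W (pivot j u uⱼ≢0 w)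
  W-pivot {j} {u} uⱼ≢0 {w} u∈ w∈ = W-- w∈ (W-* (w j * inv (u j) uⱼ≢0) u∈)

  NonzeroVanishing : List (Fin n) → Set
  NonzeroVanishing ts = ∃ λ v → W v × NonZeroVec v × Vanishes ts v

  nonzeroVanishing? : ∀ ts → Dec (NonzeroVanishing ts)
  nonzeroVanishing? ts = map′
    (λ (v , v∈ , rest) → v , span⇒inSpan B v∈ , rest)
    (λ (v , v∈ , rest) → v , inSpan⇒span B v∈ , rest)
    (nonzero-vanishing-in-span? (List.tabulate B) ts)

  elementary-by-pivot : ∀ {h j} → W h → (hⱼ≢0 : h j ≢ 0ℚ) →
                        (∀ w → W w → supp w ⊆ supp h → w j ≡ 0ℚ → IsZero w) → Elementary B h
  elementary-by-pivot {h} {j} h∈ hⱼ≢0 rigid = h∈ , (λ h≡0 → hⱼ≢0 (h≡0 j)) , minimal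
    where
    minimal : ∀ h′ → W h′ → NonZeroVec h′ → supp h′ ⊆ supp h → supp h ⊆ supp h′
    minimal h′ h′∈ h′≢0 h′⊆h = supp-⊆⁺ h′ h h′ᵢ≡0⇒hᵢ≡0
      where
      α = h′ j * inv (h j) hⱼ≢0
      h′≡αh : ∀ i → h′ i ≡ α * h i
      h′≡αh i = p-q≡0⇒p≡q _ _
        (rigid _ (W-pivot hⱼ≢0 h∈ h′∈) (supp-pivot⊆ j h hⱼ≢0 {h′} h′⊆h) (pivot-vanishes j h hⱼ≢0 h′) i)
      h′ᵢ≡0⇒hᵢ≡0 : ∀ i → h′ i ≡ 0ℚ → h i ≡ 0ℚ
      h′ᵢ≡0⇒hᵢ≡0 i h′ᵢ≡0 = decidable-stable (h i ≟ 0ℚ) λ hᵢ≢0 → h′≢0 λ l →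
        trans (h′≡αh l) (trans (cong (_* h l) (p*q≡0⇒p≡0 α (trans (sym (h′≡αh i)) h′ᵢ≡0) hᵢ≢0)) (ℚₚ.*-zeroˡ (h l)))

  elementary-proportional : ∀ {e v j} → Elementary B e → W v → supp v ⊆ supp e → (eⱼ≢0 : e j ≢ 0ℚ) →
                            ∀ l → v l ≡ (v j * inv (e j) eⱼ≢0) * e l
  elementary-proportional {e} {v} {j} (e∈ , _ , minimal) v∈ v⊆e eⱼ≢0 l = p-q≡0⇒p≡q _ _ (pivot≡0 l)
    where
    r = pivot j e eⱼ≢0 v
    pivot≡0 : IsZero r
    pivot≡0 = decidable-stable (isZero? r) λ r≢0 →
      ∈-supp⁻ r (minimal r (W-pivot eⱼ≢0 e∈ v∈) r≢0 (supp-pivot⊆ j e eⱼ≢0 {v} v⊆e) (∈-supp⁺ e eⱼ≢0))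
                (pivot-vanishes j e eⱼ≢0 v)

  CircuitCriterion : Subset n → Set
  CircuitCriterion C = NonzeroVanishing (outsideOf C) × (∀ j → j ∈ C → ¬ NonzeroVanishing (j ∷ outsideOf C))

  circuit⇒criterion : ∀ {C} → Circuit B C → CircuitCriterion C
  circuit⇒criterion (e , (e∈ , e≢0 , minimal) , refl) =
    (e , e∈ , e≢0 , supp⊆⇒vanishes-outside _ e ⊆-refl) ,
    λ { j j∈ (v , v∈ , v≢0 , vⱼ≡0 ∷ v-out) →
          ∈-supp⁻ v (minimal v v∈ v≢0 (vanishes-outside⇒supp⊆ _ v v-out) j∈) vⱼ≡0 }

  criterion⇒circuit : ∀ {C} → CircuitCriterion C → Circuit B C
  criterion⇒circuit {C} ((v , v∈ , v≢0 , v-out) , no-smaller) = v , elementary-by-pivot v∈ vⱼ≢0 rigid , supp≡C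
    where
    v⊆C : supp v ⊆ C
    v⊆C = vanishes-outside⇒supp⊆ C v v-out
    supp≡C : supp v ≡ C
    supp≡C = ⊆-antisym v⊆C λ {j} j∈C → ∈-supp⁺ v λ vⱼ≡0 → no-smaller j j∈C (v , v∈ , v≢0 , vⱼ≡0 ∷ v-out)
    j = proj₁ (nonzero⇒∃≢0 v v≢0)
    vⱼ≢0 = proj₂ (nonzero⇒∃≢0 v v≢0)
    rigid : ∀ w → W w → supp w ⊆ supp v → w j ≡ 0ℚ → IsZero w
    rigid w w∈ w⊆v wⱼ≡0 = decidable-stable (isZero? w) λ w≢0 →
      no-smaller j (v⊆C (∈-supp⁺ v vⱼ≢0)) (w , w∈ , w≢0 , wⱼ≡0 ∷ supp⊆⇒vanishes-outside C w (v⊆C ∘ w⊆v))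

  circuit? : ∀ C → Dec (Circuit B C)
  circuit? C = map′ criterion⇒circuit circuit⇒criterion
    (nonzeroVanishing? (outsideOf C) ×-dec Finₚ.all? (λ j → j ∈? C →-dec ¬? (nonzeroVanishing? (j ∷ outsideOf C))))

  primitiveMultiple⇒normElem : ∀ {h} → W h → (p : PrimitiveMultiple h) → IsNormElem B (supp h) (PrimitiveMultiple.vector p)
  primitiveMultiple⇒normElem {h} h∈ p =
    W-≗ (W-* scale h∈) (sym ∘ vector≡scale*u) , trans (supp-≗ vector≡scale*u) (supp-scale h scale≢0) , isPrimitive
    where open PrimitiveMultiple p

  normalised : ∀ {C} → Circuit B C → ∃ (IsNormElem B C)
  normalised (e , (e∈ , e≢0 , _) , refl) = PrimitiveMultiple.vector p , primitiveMultiple⇒normElem e∈ p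
    where p = primitiveMultiple e (proj₂ (nonzero⇒∃≢0 e e≢0))

  normElem-∣≡∣ : ∀ {C} g g′ {i} → Circuit B C → IsNormElem B C g → IsNormElem B C g′ → i ∈ C → ∣ g i ∣ ≡ ∣ g′ i ∣
  normElem-∣≡∣ g g′ {i} (e , e-elem , refl) (g∈ , supp-g , g-prim) (g′∈ , supp-g′ , g′-prim) i∈C =
    primitive-proportional⇒∣≡∣ g g′ g-prim g′-prim i λ l → ι-injective (begin
      ι (g l ℤ.* g′ i)           ≡⟨ ι-homo-* (g l) (g′ i) ⟩
      ι (g l) * ι (g′ i)         ≡⟨ cong₂ _*_ (g≡ae l) (g′≡be i) ⟩
      (a * e l) * (b * e i)      ≡⟨ solve 4 (λ a b eₗ eᵢ → (a :* eₗ) :* (b :* eᵢ) := (b :* eₗ) :* (a :* eᵢ)) refl a b (e l) (e i) ⟩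
      (b * e l) * (a * e i)      ≡⟨ cong₂ _*_ (g′≡be l) (g≡ae i) ⟨
      ι (g′ l) * ι (g i)         ≡⟨ ι-homo-* (g′ l) (g i) ⟨
      ι (g′ l ℤ.* g i)           ∎)
    where
    open ≡-Reasoning
    eᵢ≢0 = ∈-supp⁻ e i∈C
    a = ι (g i) * inv (e i) eᵢ≢0
    b = ι (g′ i) * inv (e i) eᵢ≢0
    g≡ae : ∀ l → ι (g l) ≡ a * e l
    g≡ae = elementary-proportional e-elem g∈ (⊆-reflexive supp-g) eᵢ≢0
    g′≡be : ∀ l → ι (g′ l) ≡ b * e l
    g′≡be = elementary-proportional e-elem g′∈ (⊆-reflexive supp-g′) eᵢ≢0

  -- 1, which is neutral for lcm, when C is not a circuit or i ∉ C.
  circuitEntry : Subset n → Fin n → ℕ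
  circuitEntry C i with circuit? C | i ∈? C
  ... | yes isC | yes _ = ∣ proj₁ (normalised isC) i ∣
  ... | _       | _     = 1

  κ̇ : ℕ
  κ̇ = lcmSubset (λ C → lcmFin (circuitEntry C))

  entry≡circuitEntry : ∀ {C} g {i} → Circuit B C → IsNormElem B C g → i ∈ C → ∣ g i ∣ ≡ circuitEntry C i
  entry≡circuitEntry {C} g {i} isC g-norm i∈C with circuit? C | i ∈? C
  ... | yes isC′ | yes _   = normElem-∣≡∣ g (proj₁ (normalised isC′)) isC g-norm (proj₂ (normalised isC′)) i∈C
  ... | yes _    | no i∉C  = ⊥-elim (i∉C i∈C)
  ... | no ¬isC  | _       = ⊥-elim (¬isC isC)

  circuitEntry-entry⊎1 : ∀ C i → Entry B (circuitEntry C i) ⊎ circuitEntry C i ≡ 1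
  circuitEntry-entry⊎1 C i with circuit? C | i ∈? C
  ... | yes isC | yes i∈C = inj₁ (C , proj₁ (normalised isC) , i , isC , proj₂ (normalised isC) , i∈C , refl)
  ... | yes _   | no _    = inj₂ refl
  ... | no _    | _       = inj₂ refl

  κ̇-isKappa : IsKappa B κ̇
  κ̇-isKappa = entry∣κ̇ , κ̇-least
    where
    entry∣κ̇ : ∀ a → Entry B a → a ∣ κ̇
    entry∣κ̇ _ (C , g , i , isC , g-norm , i∈C , refl) = subst (_∣ κ̇) (sym (entry≡circuitEntry g isC g-norm i∈C))
      (∣-trans (∣lcmFin (circuitEntry C) i) (∣lcmSubset (λ C → lcmFin (circuitEntry C)) C))
    κ̇-least : ∀ L → (∀ a → Entry B a → a ∣ L) → κ̇ ∣ L
    κ̇-least L entry∣L = lcmSubset-least _ λ C → lcmFin-least _ λ i → case circuitEntry-entry⊎1 C i of λ where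
      (inj₁ entry) → entry∣L _ entry
      (inj₂ ≡1)    → subst (_∣ L) (sym ≡1) (divides L (sym (ℕₚ.*-identityʳ L)))

  entry≢0 : ∀ {a} → Entry B a → a ≢ 0
  entry≢0 (C , g , i , _ , (_ , supp-g , _) , i∈C , refl) ∣gᵢ∣≡0 =
    ∈-supp⁻ (toℚv g) (subst (i ∈_) (sym supp-g) i∈C) (cong ι (ℤₚ.∣i∣≡0⇒i≡0 {g i} ∣gᵢ∣≡0))

  0<κ̇ : 0 < κ̇
  0<κ̇ = ℕₚ.n≢0⇒n>0 (lcmSubset≢0 _ λ C → lcmFin≢0 _ λ i → case circuitEntry-entry⊎1 C i of λ where
    (inj₁ entry) → entry≢0 entry
    (inj₂ ≡1)    → λ ≡0 → case trans (sym ≡1) ≡0 of λ ())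

  -- Vertices and the two bounds

  coset-+ : ∀ (d : Fin n → ℤ) (x y : Vecℚ n) → W (λ i → x i - ι (d i)) → W y → W (λ i → (x i + y i) - ι (d i))
  coset-+ d x y x-d∈ y∈ =
    W-≗ (W-+ x-d∈ y∈) (λ i → solve 3 (λ x d y → (x :- d) :+ y := (x :+ y) :- d) refl (x i) (ι (d i)) (y i))

  coset-- : ∀ (d : Fin n → ℤ) (x y : Vecℚ n) → W (λ i → x i - ι (d i)) → W y → W (λ i → (x i - y i) - ι (d i))
  coset-- d x y x-d∈ y∈ =
    W-≗ (W-- x-d∈ y∈) (λ i → solve 3 (λ x d y → (x :- d) :- y := (x :- y) :- d) refl (x i) (ι (d i)) (y i))

  coset-difference : ∀ (d : Fin n → ℤ) (x y : Vecℚ n) → W (λ i → (x i + y i) - ι (d i)) → W (λ i → x i - ι (d i)) → W y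
  coset-difference d x y x+y-d∈ x-d∈ =
    W-≗ (W-- x+y-d∈ x-d∈) (λ i → solve 3 (λ x y d → (x :+ y :- d) :- (x :- d) := y) refl (x i) (y i) (ι (d i)))

  SupportsNoDirection : Vecℚ n → Set
  SupportsNoDirection x = ∀ h → W h → supp h ⊆ supp x → IsZero h

  vertex⇒supportsNoDirection : ∀ {d x} → Vertex B d x → SupportsNoDirection x
  vertex⇒supportsNoDirection {d} {x} ((x-d∈ , 0≤x) , extreme) h h∈ h⊆x i =
    p*q≡0⇒p≡0 (h i) (trans (ℚₚ.*-comm (h i) ε) (extreme εh x+εh∈ x-εh∈ i)) ε≢0
    where
    perturbed = perturbation x h 0≤x (supp-⊆⁻ x h h⊆x)
    ε = proj₁ perturbed
    ε≢0 = proj₁ (proj₂ perturbed)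
    εh : Vecℚ n
    εh i = ε * h i
    x+εh∈ : InPoly B d (λ i → x i + εh i)
    x+εh∈ = coset-+ d x εh x-d∈ (W-* ε h∈) , λ i → proj₁ (proj₂ (proj₂ perturbed) i)
    x-εh∈ : InPoly B d (λ i → x i - εh i)
    x-εh∈ = coset-- d x εh x-d∈ (W-* ε h∈) , λ i → proj₂ (proj₂ (proj₂ perturbed) i)

  supportsNoDirection⇒vertex : ∀ {d x} → InPoly B d x → SupportsNoDirection x → Vertex B d x
  supportsNoDirection⇒vertex {d} {x} x∈@(x-d∈ , _) rigid = x∈ , λ y (x+y-d∈ , 0≤x+y) (_ , 0≤x-y) →
    rigid y (coset-difference d x y x+y-d∈ x-d∈) (supp-⊆⁺ x y λ i xᵢ≡0 →
      0≤0+p∧0≤0-p⇒p≡0 (subst (λ a → 0ℚ ℚ.≤ a + y i) xᵢ≡0 (0≤x+y i)) (subst (λ a → 0ℚ ℚ.≤ a - y i) xᵢ≡0 (0≤x-y i)))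

  elementary-ratio-integral : ∀ {κ} → (∀ a → Entry B a → a ∣ κ) → ∀ {h j} → Elementary B h → (hⱼ≢0 : h j ≢ 0ℚ) →
                              ∀ l → Integral (ι (+ κ) * (h l * inv (h j) hⱼ≢0))
  elementary-ratio-integral {κ} entry∣κ {h} {j} h-elem@(h∈ , _) hⱼ≢0 l =
    subst Integral (sym κ*h/h≡q*g) (integral-* (integral-ι q) (integral-ι (g l)))
    where
    open PrimitiveMultiple (primitiveMultiple h hⱼ≢0)
    g = vector
    gⱼ≢0 : ι (g j) ≢ 0ℚ
    gⱼ≢0 gⱼ≡0 = *-≢0 scale≢0 hⱼ≢0 (trans (sym (vector≡scale*u j)) gⱼ≡0)
    gⱼ∣κ : g j ℤ∣.∣ + κ
    gⱼ∣κ = ℤ∣.∣ᵤ⇒∣ (entry∣κ ∣ g j ∣ (supp h , g , j , (h , h-elem , refl) ,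
                              primitiveMultiple⇒normElem h∈ (primitiveMultiple h hⱼ≢0) , ∈-supp⁺ h hⱼ≢0 , refl))
    q = ℤ∣.quotient gⱼ∣κ
    h/h≡g/g : h l * inv (h j) hⱼ≢0 ≡ ι (g l) * inv (ι (g j)) gⱼ≢0
    h/h≡g/g = cross-multiply (h l) (h j) (ι (g l)) (ι (g j)) hⱼ≢0 gⱼ≢0 (begin
      h l * ι (g j)          ≡⟨ cong (h l *_) (vector≡scale*u j) ⟩
      h l * (scale * h j)    ≡⟨ solve 3 (λ a s b → a :* (s :* b) := (s :* a) :* b) refl (h l) scale (h j) ⟩
      (scale * h l) * h j    ≡⟨ cong (_* h j) (vector≡scale*u l) ⟨
      ι (g l) * h j          ∎)
      where open ≡-Reasoning
    κ*h/h≡q*g : ι (+ κ) * (h l * inv (h j) hⱼ≢0) ≡ ι q * ι (g l)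
    κ*h/h≡q*g = begin
      ι (+ κ) * (h l * inv (h j) hⱼ≢0)   ≡⟨ cong₂ _*_ (trans (cong ι (ℤ∣._∣_.equality gⱼ∣κ)) (ι-homo-* q (g j))) h/h≡g/g ⟩
      (ι q * ι (g j)) * (ι (g l) * r)     ≡⟨ solve 4 (λ q gⱼ gₗ r → (q :* gⱼ) :* (gₗ :* r) := (q :* gₗ) :* (gⱼ :* r))
                                                     refl (ι q) (ι (g j)) (ι (g l)) r ⟩
      (ι q * ι (g l)) * (ι (g j) * r)     ≡⟨ cong ((ι q * ι (g l)) *_) (*-inverseʳ (ι (g j)) gⱼ≢0) ⟩
      (ι q * ι (g l)) * 1ℚ                ≡⟨ ℚₚ.*-identityʳ (ι q * ι (g l)) ⟩
      ι q * ι (g l)                       ∎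
      where
      open ≡-Reasoning
      r = inv (ι (g j)) gⱼ≢0

  module _ {κ : ℕ} (entry∣κ : ∀ a → Entry B a → a ∣ κ) where

    -- R: coordinates still to be treated, where v is integral; Z: coordinates already
    -- cleared, where v vanishes.
    scaled-integral : ∀ R Z → (∀ w → W w → Vanishes Z w → Vanishes R w → IsZero w) →
                      ∀ v → W v → Vanishes Z v → All (Integral ∘ v) R → ∀ l → Integral (ι (+ κ) * v l)
    scaled-integral [] Z rigid v v∈ v-Z [] l =
      + 0 , trans (cong (ι (+ κ) *_) (rigid v v∈ v-Z [] l)) (ℚₚ.*-zeroʳ (ι (+ κ)))
    scaled-integral (j ∷ R) Z rigid v v∈ v-Z (vⱼ-integral ∷ v-R-integral) with nonzeroVanishing? (Z List.++ R)
    ... | no none = scaled-integral R Z rigid′ v v∈ v-Z v-R-integral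
      where
      rigid′ : ∀ w → W w → Vanishes Z w → Vanishes R w → IsZero w
      rigid′ w w∈ w-Z w-R = decidable-stable (isZero? w) λ w≢0 → none (w , w∈ , w≢0 , Allₚ.++⁺ w-Z w-R)
    ... | yes (h , h∈ , h≢0 , h-ZR) = λ l →
      subst Integral (sym (split l))
            (integral-+ (v′-integral l) (integral-* vⱼ-integral (elementary-ratio-integral entry∣κ h-elem hⱼ≢0 l)))
      where
      h-Z = proj₁ (Allₚ.++⁻ Z h-ZR)
      h-R = proj₂ (Allₚ.++⁻ Z h-ZR)
      hⱼ≢0 : h j ≢ 0ℚ
      hⱼ≢0 hⱼ≡0 = h≢0 (rigid h h∈ h-Z (hⱼ≡0 ∷ h-R))
      vanishes-within : ∀ {w} ts → supp w ⊆ supp h → Vanishes ts h → Vanishes ts w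
      vanishes-within {w} ts w⊆h = All.map (λ {t} → supp-⊆⁻ h w w⊆h t)
      h-elem : Elementary B h
      h-elem = elementary-by-pivot h∈ hⱼ≢0 λ w w∈ w⊆h wⱼ≡0 →
        rigid w w∈ (vanishes-within Z w⊆h h-Z) (wⱼ≡0 ∷ vanishes-within R w⊆h h-R)
      v′ = pivot j h hⱼ≢0 v
      v′-jZ : Vanishes (j ∷ Z) v′
      v′-jZ = pivot-vanishes j h hⱼ≢0 v ∷
              All.zipWith (λ {t} (vₜ≡0 , hₜ≡0) → trans (pivot-where-zero j h hⱼ≢0 v hₜ≡0) vₜ≡0) (v-Z , h-Z)
      v′-R-integral : All (Integral ∘ v′) R
      v′-R-integral = All.zipWith (λ {t} (vₜ-integral , hₜ≡0) →
        subst Integral (sym (pivot-where-zero j h hⱼ≢0 v hₜ≡0)) vₜ-integral) (v-R-integral , h-R)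
      v′-integral : ∀ l → Integral (ι (+ κ) * v′ l)
      v′-integral = scaled-integral R (j ∷ Z) (λ { w w∈ (wⱼ≡0 ∷ w-Z) w-R → rigid w w∈ w-Z (wⱼ≡0 ∷ w-R) })
                                    v′ (W-pivot hⱼ≢0 h∈ v∈) v′-jZ v′-R-integral
      split : ∀ l → ι (+ κ) * v l ≡ ι (+ κ) * v′ l + v j * (ι (+ κ) * (h l * inv (h j) hⱼ≢0))
      split l = solve 5 (λ k vₗ vⱼ hₗ r → k :* vₗ := k :* (vₗ :- (vⱼ :* r) :* hₗ) :+ vⱼ :* (k :* (hₗ :* r)))
                        refl (ι (+ κ)) (v l) (v j) (h l) (inv (h j) hⱼ≢0)

    commonMultiple⇒polyIntegral : AllPolyIntegral B κ
    commonMultiple⇒polyIntegral d x x-vertex@((x-d∈ , _) , _) i =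
      subst Integral (sym (split i))
            (integral-+ (scaled-integral R [] rigid x-d x-d∈ [] R-integral i) (integral-ι (+ κ ℤ.* d i)))
      where
      x-d : Vecℚ n
      x-d t = x t - ι (d t)
      R = List.filter (λ t → x t ≟ 0ℚ) (List.allFin n)
      rigid : ∀ w → W w → Vanishes [] w → Vanishes R w → IsZero w
      rigid w w∈ _ w-R = vertex⇒supportsNoDirection {d} x-vertex w w∈
        (supp-⊆⁺ x w λ t xₜ≡0 → All.lookup w-R (∈-filter⁺ (λ t → x t ≟ 0ℚ) (∈-allFin t) xₜ≡0))
      R-integral : All (Integral ∘ x-d) R
      R-integral = All.tabulate λ {t} t∈R →
        subst Integral (cong (_- ι (d t)) (sym (proj₂ (∈-filter⁻ (λ t → x t ≟ 0ℚ) {xs = List.allFin n} t∈R))))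
              (integral-- (integral-ι (+ 0)) (integral-ι (d t)))
      split : ∀ i → ι (+ κ) * x i ≡ ι (+ κ) * x-d i + ι (+ κ ℤ.* d i)
      split i = trans (solve 3 (λ k x d → k :* x := k :* (x :- d) :+ k :* d) refl (ι (+ κ)) (x i) (ι (d i)))
                      (cong (λ r → ι (+ κ) * x-d i + r) (sym (ι-homo-* (+ κ) (d i))))

  vertexOffset : (Fin n → ℤ) → Fin n → Fin n → ℤ
  vertexOffset g i l with l Finₚ.≟ i
  ... | yes _ = + 1
  ... | no _  = + ∣ g l ∣

  circuit-vertex : ∀ {C} g {i} → Circuit B C → IsNormElem B C g → i ∈ C → (gᵢ≢0 : ι (g i) ≢ 0ℚ) →
                   Vertex B (vertexOffset g i) (λ l → ι (vertexOffset g i l) - ι (g l) * inv (ι (g i)) gᵢ≢0)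
  circuit-vertex g {i} (e , e-elem , refl) (g∈ , supp-g , _) i∈C gᵢ≢0 =
    supportsNoDirection⇒vertex {d} {x} (x-d∈ , 0≤x) noDirection
    where
    ig = inv (ι (g i)) gᵢ≢0
    d = vertexOffset g i
    x : Vecℚ n
    x l = ι (d l) - ι (g l) * ig
    x-d∈ : W (λ l → x l - ι (d l))
    x-d∈ = W-≗ (W-* (- ig) g∈) λ l →
      solve 3 (λ dₗ gₗ r → (:- r) :* gₗ := (dₗ :- gₗ :* r) :- dₗ) refl (ι (d l)) (ι (g l)) ig
    xᵢ≡0 : x i ≡ 0ℚ
    xᵢ≡0 with i Finₚ.≟ i
    ... | yes _   = cong (λ r → 1ℚ - r) (*-inverseʳ (ι (g i)) gᵢ≢0)
    ... | no i≢i = ⊥-elim (i≢i refl)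
    0≤x : ∀ l → 0ℚ ℚ.≤ x l
    0≤x l with l Finₚ.≟ i
    ... | yes refl = ℚₚ.≤-reflexive (sym (cong (λ r → 1ℚ - r) (*-inverseʳ (ι (g i)) gᵢ≢0)))
    ... | no _     = p≤q⇒0≤q-p (ι-ratio≤∣numerator∣ (g l) (g i) gᵢ≢0)
    x-outside : ∀ l → l ∉ supp e → x l ≡ 0ℚ
    x-outside l l∉e with l Finₚ.≟ i
    ... | yes refl = ⊥-elim (l∉e i∈C)
    ... | no _     = trans (cong (λ z → ι (+ ∣ z ∣) - ι z * ig) gₗ≡0) (cong (λ r → 0ℚ - r) (ℚₚ.*-zeroˡ ig))
      where
      gₗ≡0 : g l ≡ + 0
      gₗ≡0 = ι-injective (∉-supp⁻ (toℚv g) (l∉e ∘ subst (l ∈_) supp-g))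
    noDirection : SupportsNoDirection x
    noDirection h h∈ h⊆x l = begin
      h l                          ≡⟨ elementary-proportional e-elem h∈ h⊆e eᵢ≢0 l ⟩
      (h i * inv (e i) eᵢ≢0) * e l ≡⟨ cong (λ a → (a * inv (e i) eᵢ≢0) * e l) (supp-⊆⁻ x h h⊆x i xᵢ≡0) ⟩
      (0ℚ * inv (e i) eᵢ≢0) * e l  ≡⟨ solve 2 (λ r eₗ → (con 0ℚ :* r) :* eₗ := con 0ℚ) refl (inv (e i) eᵢ≢0) (e l) ⟩
      0ℚ                           ∎
      where
      open ≡-Reasoning
      eᵢ≢0 = ∈-supp⁻ e i∈C
      x⊆e : supp x ⊆ supp e
      x⊆e = supp-⊆⁺ e x (λ l eₗ≡0 → x-outside l (λ l∈e → ∈-supp⁻ e l∈e eₗ≡0))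
      h⊆e : supp h ⊆ supp e
      h⊆e = x⊆e ∘ h⊆x

  polyIntegral⇒entry∣ : ∀ {k} → AllPolyIntegral B k → ∀ a → Entry B a → a ∣ k
  polyIntegral⇒entry∣ {k} polyIntegral _ (C , g , i , isC , g-norm@(_ , supp-g , g-prim) , i∈C , refl) =
    primitive-∣ g g-prim λ l → integral-ratio⇒∣ k (g l) (g i) gᵢ≢0 (k*ratio-integral l)
    where
    gᵢ≢0 : ι (g i) ≢ 0ℚ
    gᵢ≢0 = ∈-supp⁻ (toℚv g) (subst (i ∈_) (sym supp-g) i∈C)
    d = vertexOffset g i
    k*ratio-integral : ∀ l → Integral (ι (+ k) * (ι (g l) * inv (ι (g i)) gᵢ≢0))
    k*ratio-integral l = subst Integral
      (solve 3 (λ k dₗ q → k :* dₗ :- k :* (dₗ :- q) := k :* q) refl (ι (+ k)) (ι (d l)) (ι (g l) * inv (ι (g i)) gᵢ≢0))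
      (integral-- (integral-* (integral-ι (+ k)) (integral-ι (d l)))
                  (polyIntegral d _ (circuit-vertex g isC g-norm i∈C gᵢ≢0) l))

theorem3p8 : (n m : ℕ) (B : Fin m → Vecℚ n) →
    Σ ℕ (λ κ → IsKappa B κ × 0 < κ × AllPolyIntegral B κ ×
      ((k : ℕ) → 0 < k → AllPolyIntegral B k → κ ≤ k))
theorem3p8 n m B =
  κ̇ B , κ̇-isKappa B , 0<κ̇ B , commonMultiple⇒polyIntegral B (proj₁ (κ̇-isKappa B)) ,
  λ k 0<k polyIntegral → ∣⇒≤ {{ℕ.>-nonZero 0<k}} (proj₂ (κ̇-isKappa B) k (polyIntegral⇒entry∣ B polyIntegral))
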